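{- For any positive integer $n$ and any $y$, \[ \sum_{r=1}^{n}r\,\tilde{w}_{n,r}(y)=w_{n}(y). \]
   Context: ${n\brace k}$ denotes the Stirling number of the second kind. $w_n(y)=\sum_{k=0}^n{n\brace k}k!y^k$. $d_{k,r}$ is the number of permutations of a $k$-set with exactly $r$ fixed points ($d_{k,r}=\binom{k}{r}d_{k-r}$ for $k\ge r$, $0$ otherwise, $d_m=m!\sum_{i=0}^m(-1)^i/i!$); $\tilde{w}_{n,r}(y)=\sum_{k=0}^n{n\brace k}d_{k,r}y^k$. -}

module Defs where

open import Data.Nat as ℕ using (ℕ; zero; suc; _∸_)
open import Data.Nat.Combinatorics using (_C_)
open import Data.Nat using (_!)
open import Data.Bool using (true; false)
open import Data.Integer using (ℤ; +_; _+_; _*_; -_; _^_)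

-- Σ[ i ∈ [a, b] ] f i  : sum of f i over a ≤ i ≤ b (empty if b < a)
sumFromTo : ℕ → ℕ → (ℕ → ℤ) → ℤ
sumFromTo a b f = go (suc b ∸ a)
  where
  go : ℕ → ℤ
  go zero    = + 0
  go (suc m) = go m + f (a ℕ.+ m)

stirling2 : ℕ → ℕ → ℕ
stirling2 zero    zero    = 1
stirling2 zero    (suc k) = 0
stirling2 (suc n) zero    = 0
stirling2 (suc n) (suc k) = suc k ℕ.* stirling2 n (suc k) ℕ.+ stirling2 n k

-- falling quotient m! / i! = (i+1)(i+2)...m  (for i ≤ m), exact in ℕ
ratFact : ℕ → ℕ → ℕ
ratFact m i = go (m ∸ i)
  where
  go : ℕ → ℕ
  go zero    = 1
  go (suc j) = (i ℕ.+ suc j) ℕ.* go j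

-- derangement numbers d_m = m! Σ_{i=0}^m (-1)^i / i! = Σ_{i=0}^m (-1)^i m!/i!
derange : ℕ → ℤ
derange m = sumFromTo 0 m (λ i → ((- (+ 1)) ^ i) * (+ ratFact m i))

dkr : ℕ → ℕ → ℤ
dkr k r with r ℕ.≤ᵇ k
... | true  = + (k C r) * derange (k ∸ r)
... | false = + 0

w : ℕ → ℤ → ℤ
w n y = sumFromTo 0 n (λ k → + (stirling2 n k ℕ.* (k !)) * (y ^ k))

wt : ℕ → ℕ → ℤ → ℤ
wt n r y = sumFromTo 0 n (λ k → + (stirling2 n k) * dkr k r * (y ^ k))

{-# OPTIONS --safe #-}
-- Σ_r r·d_{k,r} counts the fixed points of all permutations of a k-set; each point is fixed by
-- (k−1)! of them, so the sum is k! for k ≥ 1. Algebraically, r·C(k,r) = k·C(k−1,r−1) turns it into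
-- k·Σ_j C(k−1,j)·d_j, and Σ_j C(m,j)·d_j = m! follows by induction from d_{m+1} = (m+1)·d_m + (−1)^{m+1}
-- and the vanishing of alternating binomial sums. Exchanging the sums over r and k in Σ_r r·w̃_{n,r}(y)
-- then collapses the coefficient of y^k to {n brace k}·k!; for k = 0 both sides vanish because
-- {n brace 0} = 0 when n ≥ 1.
module Submission where

open import Defs
open import Data.Nat using (ℕ; suc)
open import Data.Integer using (ℤ; +_; _*_)
open import Relation.Binary.PropositionalEquality using (_≡_)

open import Data.Nat as ℕ using (zero; _∸_; _!; _≤_; _<_; _≤′_; ≤′-refl; ≤′-step; s≤s; _≤ᵇ_; _⊓_)
import Data.Nat.Properties as ℕ
open import Data.Nat.Combinatorics.Base using (_C′_)
open import Data.Nat.Combinatorics using (_C_; nCk+nC[k+1]≡[n+1]C[k+1]; nCk≡nC[n∸k]; nC1≡n; k>n⇒nCk≡0)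
open import Data.Integer using (-_; _+_; _^_; -1ℤ; 1ℤ)
open import Data.Integer.Properties
  using (pos-*; pos-+; +-identityʳ; +-comm; +-assoc; +-inverseʳ; *-identityʳ; *-zeroʳ; *-comm; *-assoc; *-distribˡ-+;
         +-commutativeSemigroup; *-commutativeSemigroup)
open import Data.Integer.Tactic.RingSolver using (solve-∀)
import Algebra.Properties.CommutativeSemigroup +-commutativeSemigroup as +-Comm
import Algebra.Properties.CommutativeSemigroup *-commutativeSemigroup as *-Comm
open import Data.Bool using (true; false; if_then_else_)
open import Data.Unit using (tt)
open import Data.Empty using (⊥-elim)
open import Relation.Binary.PropositionalEquality using (refl; sym; trans; cong; cong₂; module ≡-Reasoning)
open ≡-Reasoning

∑ : ℕ → (ℕ → ℤ) → ℤ
∑ zero    f = + 0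
∑ (suc m) f = ∑ m f + f m

syntax ∑ m (λ i → x) = ∑[ i < m ] x

sumFromTo-0 : ∀ b f → sumFromTo 0 b f ≡ ∑[ i < suc b ] f i
sumFromTo-0 zero    f = refl
sumFromTo-0 (suc b) f = cong (_+ f (suc b)) (sumFromTo-0 b f)

sumFromTo-1 : ∀ b f → sumFromTo 1 b f ≡ ∑[ i < b ] f (suc i)
sumFromTo-1 zero    f = refl
sumFromTo-1 (suc b) f = cong (_+ f (suc b)) (sumFromTo-1 b f)

∑-cong-< : ∀ m {f g : ℕ → ℤ} → (∀ i → i < m → f i ≡ g i) → ∑ m f ≡ ∑ m g
∑-cong-< zero    f≡g = refl
∑-cong-< (suc m) f≡g =
  cong₂ _+_ (∑-cong-< m (λ i i<m → f≡g i (ℕ.m<n⇒m<1+n i<m))) (f≡g m (ℕ.n<1+n m))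

∑-cong : ∀ m {f g : ℕ → ℤ} → (∀ i → f i ≡ g i) → ∑ m f ≡ ∑ m g
∑-cong m f≡g = ∑-cong-< m (λ i _ → f≡g i)

∑-zero : ∀ m → ∑[ i < m ] (+ 0) ≡ + 0
∑-zero zero    = refl
∑-zero (suc m) = trans (+-identityʳ _) (∑-zero m)

∑-distrib-+ : ∀ m (f g : ℕ → ℤ) → ∑[ i < m ] (f i + g i) ≡ ∑ m f + ∑ m g
∑-distrib-+ zero    f g = refl
∑-distrib-+ (suc m) f g = begin
  ∑[ i < m ] (f i + g i) + (f m + g m) ≡⟨ cong (_+ (f m + g m)) (∑-distrib-+ m f g) ⟩
  (∑ m f + ∑ m g) + (f m + g m)        ≡⟨ +-Comm.interchange (∑ m f) (∑ m g) (f m) (g m) ⟩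
  (∑ m f + f m) + (∑ m g + g m)        ∎

∑-distribˡ-* : ∀ m c (f : ℕ → ℤ) → ∑[ i < m ] (c * f i) ≡ c * ∑ m f
∑-distribˡ-* zero    c f = sym (*-zeroʳ c)
∑-distribˡ-* (suc m) c f =
  trans (cong (_+ c * f m) (∑-distribˡ-* m c f)) (sym (*-distribˡ-+ c (∑ m f) (f m)))

∑-comm : ∀ m n (f : ℕ → ℕ → ℤ) → ∑[ i < m ] ∑[ j < n ] f i j ≡ ∑[ j < n ] ∑[ i < m ] f i j
∑-comm zero    n f = sym (∑-zero n)
∑-comm (suc m) n f = begin
  ∑[ i < m ] ∑[ j < n ] f i j + ∑[ j < n ] f m j ≡⟨ cong (_+ ∑[ j < n ] f m j) (∑-comm m n f) ⟩
  ∑[ j < n ] ∑[ i < m ] f i j + ∑[ j < n ] f m j ≡⟨ sym (∑-distrib-+ n (λ j → ∑[ i < m ] f i j) (f m)) ⟩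
  ∑[ j < n ] (∑[ i < m ] f i j + f m j)          ∎

∑-head : ∀ m (f : ℕ → ℤ) → ∑ (suc m) f ≡ f 0 + ∑[ i < m ] f (suc i)
∑-head zero    f = +-comm (+ 0) (f 0)
∑-head (suc m) f = trans (cong (_+ f (suc m)) (∑-head m f)) (+-assoc (f 0) _ _)

∑-reverse : ∀ m (f : ℕ → ℤ) → ∑ (suc m) f ≡ ∑[ i < suc m ] f (m ∸ i)
∑-reverse zero    f = refl
∑-reverse (suc m) f = begin
  ∑ (suc m) f + f (suc m)                          ≡⟨ cong (_+ f (suc m)) (∑-reverse m f) ⟩
  ∑[ i < suc m ] f (m ∸ i) + f (suc m)             ≡⟨ +-comm _ (f (suc m)) ⟩
  f (suc m) + ∑[ i < suc m ] f (m ∸ i)             ≡⟨ sym (∑-head (suc m) (λ i → f (suc m ∸ i))) ⟩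
  ∑[ i < suc (suc m) ] f (suc m ∸ i)               ∎

∑-telescope : ∀ m (f : ℕ → ℤ) → ∑[ j < m ] (f (suc j) + - f j) ≡ f m + - f 0
∑-telescope zero    f = sym (+-inverseʳ (f 0))
∑-telescope (suc m) f = begin
  ∑[ j < m ] (f (suc j) + - f j) + (f (suc m) + - f m) ≡⟨ cong (_+ (f (suc m) + - f m)) (∑-telescope m f) ⟩
  (f m + - f 0) + (f (suc m) + - f m)                  ≡⟨ cancel (f m) (f 0) (f (suc m)) ⟩
  f (suc m) + - f 0                                    ∎
  where
  cancel : ∀ a b c → (a + - b) + (c + - a) ≡ c + - b
  cancel = solve-∀

∑-pad : ∀ {m n} (f : ℕ → ℤ) → m ≤′ n → (∀ i → m ≤ i → f i ≡ + 0) → ∑ n f ≡ ∑ m f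
∑-pad f ≤′-refl            vanish = refl
∑-pad {m} f (≤′-step {n} m≤′n) vanish = begin
  ∑ n f + f n ≡⟨ cong₂ _+_ (∑-pad f m≤′n vanish) (vanish n (ℕ.≤′⇒≤ m≤′n)) ⟩
  ∑ m f + + 0 ≡⟨ +-identityʳ (∑ m f) ⟩
  ∑ m f       ∎

[k+1]*[n+1]C[k+1]≡[n+1]*nCk : ∀ n k → suc k ℕ.* (suc n C suc k) ≡ suc n ℕ.* (n C k)
[k+1]*[n+1]C[k+1]≡[n+1]*nCk zero    zero    = refl
[k+1]*[n+1]C[k+1]≡[n+1]*nCk zero    (suc k) = ℕ.*-zeroʳ (suc (suc k))
[k+1]*[n+1]C[k+1]≡[n+1]*nCk (suc n) zero    =
  trans (ℕ.*-identityˡ _) (trans (nC1≡n (suc (suc n))) (sym (ℕ.*-identityʳ (suc (suc n)))))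
[k+1]*[n+1]C[k+1]≡[n+1]*nCk (suc n) (suc k) = begin
  suc (suc k) ℕ.* (suc (suc n) C suc (suc k))
    ≡⟨ cong (suc (suc k) ℕ.*_) (sym (nCk+nC[k+1]≡[n+1]C[k+1] (suc n) (suc k))) ⟩
  suc (suc k) ℕ.* (a ℕ.+ b)
    ≡⟨ ℕ.*-distribˡ-+ (suc (suc k)) a b ⟩
  (a ℕ.+ suc k ℕ.* a) ℕ.+ suc (suc k) ℕ.* b
    ≡⟨ ℕ.+-assoc a (suc k ℕ.* a) _ ⟩
  a ℕ.+ (suc k ℕ.* a ℕ.+ suc (suc k) ℕ.* b)
    ≡⟨ cong (a ℕ.+_) (cong₂ ℕ._+_ ([k+1]*[n+1]C[k+1]≡[n+1]*nCk n k) ([k+1]*[n+1]C[k+1]≡[n+1]*nCk n (suc k))) ⟩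
  a ℕ.+ (suc n ℕ.* (n C k) ℕ.+ suc n ℕ.* (n C suc k))
    ≡⟨ cong (a ℕ.+_) (sym (ℕ.*-distribˡ-+ (suc n) (n C k) (n C suc k))) ⟩
  a ℕ.+ suc n ℕ.* (n C k ℕ.+ n C suc k)
    ≡⟨ cong (λ c → a ℕ.+ suc n ℕ.* c) (nCk+nC[k+1]≡[n+1]C[k+1] n k) ⟩
  suc (suc n) ℕ.* a
    ∎
  where
  a b : ℕ
  a = suc n C suc k
  b = suc n C suc (suc k)

+[k+1]*+[n+1]C[k+1]≡+[n+1]*+nCk : ∀ n k → + suc k * + (suc n C suc k) ≡ + suc n * + (n C k)
+[k+1]*+[n+1]C[k+1]≡+[n+1]*+nCk n k = begin
  + suc k * + (suc n C suc k)    ≡⟨ pos-* (suc k) (suc n C suc k) ⟨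
  + (suc k ℕ.* (suc n C suc k))  ≡⟨ cong +_ ([k+1]*[n+1]C[k+1]≡[n+1]*nCk n k) ⟩
  + (suc n ℕ.* (n C k))          ≡⟨ pos-* (suc n) (n C k) ⟩
  + suc n * + (n C k)            ∎

∑-alternating-binomial≡0 : ∀ n → ∑[ j < suc (suc n) ] (+ (suc n C j) * -1ℤ ^ j) ≡ + 0
∑-alternating-binomial≡0 n = begin
  ∑[ j < suc (suc n) ] (+ (suc n C j) * -1ℤ ^ j)
    ≡⟨ ∑-head (suc n) _ ⟩
  1ℤ + ∑[ j < suc n ] (+ (suc n C suc j) * -1ℤ ^ suc j)
    ≡⟨ cong (_+_ 1ℤ) (∑-cong (suc n) pascal) ⟩
  1ℤ + ∑[ j < suc n ] (u (suc j) + - u j)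
    ≡⟨ cong (_+_ 1ℤ) (∑-telescope (suc n) u) ⟩
  1ℤ + (u (suc n) + - 1ℤ)
    ≡⟨ cong (λ c → 1ℤ + (+ c * -1ℤ ^ suc n + - 1ℤ)) (k>n⇒nCk≡0 (ℕ.n<1+n n)) ⟩
  + 0
    ∎
  where
  u : ℕ → ℤ
  u j = + (n C j) * -1ℤ ^ j
  pascal : ∀ j → + (suc n C suc j) * -1ℤ ^ suc j ≡ u (suc j) + - u j
  pascal j = begin
    + (suc n C suc j) * (-1ℤ * -1ℤ ^ j)
      ≡⟨ cong (λ c → + c * (-1ℤ * -1ℤ ^ j)) (sym (nCk+nC[k+1]≡[n+1]C[k+1] n j)) ⟩
    + (n C j ℕ.+ n C suc j) * (-1ℤ * -1ℤ ^ j)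
      ≡⟨ cong (_* (-1ℤ * -1ℤ ^ j)) (pos-+ (n C j) (n C suc j)) ⟩
    (+ (n C j) + + (n C suc j)) * (-1ℤ * -1ℤ ^ j)
      ≡⟨ expand (+ (n C j)) (+ (n C suc j)) (-1ℤ ^ j) ⟩
    + (n C suc j) * (-1ℤ * -1ℤ ^ j) + - u j
      ∎
    where
    expand : ∀ a b s → (a + b) * (-1ℤ * s) ≡ b * (-1ℤ * s) + - (a * s)
    expand = solve-∀

ratFact-suc : ∀ {m i} → i ≤ m → ratFact (suc m) i ≡ suc m ℕ.* ratFact m i
ratFact-suc {m} {i} i≤m rewrite ℕ.+-∸-assoc 1 i≤m =
  cong (ℕ._* ratFact m i) (trans (ℕ.+-suc i (m ∸ i)) (cong suc (ℕ.m+[n∸m]≡n i≤m)))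

ratFact-diag : ∀ m → ratFact m m ≡ 1
ratFact-diag m rewrite ℕ.n∸n≡0 m = refl

derange-suc : ∀ m → derange (suc m) ≡ + suc m * derange m + -1ℤ ^ suc m
derange-suc m = begin
  derange (suc m)
    ≡⟨ sumFromTo-0 (suc m) (term (suc m)) ⟩
  ∑[ i < suc m ] term (suc m) i + term (suc m) (suc m)
    ≡⟨ cong₂ _+_ (∑-cong-< (suc m) lower) (cong (λ c → -1ℤ ^ suc m * + c) (ratFact-diag (suc m))) ⟩
  ∑[ i < suc m ] (+ suc m * term m i) + -1ℤ ^ suc m * 1ℤ
    ≡⟨ cong₂ _+_ (∑-distribˡ-* (suc m) (+ suc m) (term m)) (*-identityʳ (-1ℤ ^ suc m)) ⟩
  + suc m * ∑[ i < suc m ] term m i + -1ℤ ^ suc m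
    ≡⟨ cong (λ d → + suc m * d + -1ℤ ^ suc m) (sym (sumFromTo-0 m (term m))) ⟩
  + suc m * derange m + -1ℤ ^ suc m
    ∎
  where
  term : ℕ → ℕ → ℤ
  term m i = -1ℤ ^ i * + ratFact m i
  lower : ∀ i → i < suc m → term (suc m) i ≡ + suc m * term m i
  lower i (s≤s i≤m) = begin
    -1ℤ ^ i * + ratFact (suc m) i          ≡⟨ cong (λ c → -1ℤ ^ i * + c) (ratFact-suc i≤m) ⟩
    -1ℤ ^ i * + (suc m ℕ.* ratFact m i)    ≡⟨ cong (-1ℤ ^ i *_) (pos-* (suc m) (ratFact m i)) ⟩
    -1ℤ ^ i * (+ suc m * + ratFact m i)    ≡⟨ *-Comm.x∙yz≈y∙xz (-1ℤ ^ i) (+ suc m) (+ ratFact m i) ⟩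
    + suc m * term m i                     ∎

∑-binomial-derange≡! : ∀ m → ∑[ j < suc m ] (+ (m C j) * derange j) ≡ + (m !)
∑-binomial-derange≡! zero    = refl
∑-binomial-derange≡! (suc m) = begin
  ∑[ j < suc (suc m) ] (+ (suc m C j) * derange j)
    ≡⟨ ∑-head (suc m) _ ⟩
  1ℤ + ∑[ j < suc m ] (+ (suc m C suc j) * derange (suc j))
    ≡⟨ cong (_+_ 1ℤ) (∑-cong (suc m) split) ⟩
  1ℤ + ∑[ j < suc m ] (+ suc m * a j + b j)
    ≡⟨ cong (_+_ 1ℤ) (∑-distrib-+ (suc m) (λ j → + suc m * a j) b) ⟩
  1ℤ + (∑[ j < suc m ] (+ suc m * a j) + ∑ (suc m) b)
    ≡⟨ +-Comm.x∙yz≈y∙xz 1ℤ (∑[ j < suc m ] (+ suc m * a j)) (∑ (suc m) b) ⟩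
  ∑[ j < suc m ] (+ suc m * a j) + (1ℤ + ∑ (suc m) b)
    ≡⟨ cong₂ _+_ (∑-distribˡ-* (suc m) (+ suc m) a) (trans (sym (∑-head (suc m) _)) (∑-alternating-binomial≡0 m)) ⟩
  + suc m * ∑ (suc m) a + + 0
    ≡⟨ +-identityʳ _ ⟩
  + suc m * ∑ (suc m) a
    ≡⟨ cong (+ suc m *_) (∑-binomial-derange≡! m) ⟩
  + suc m * + (m !)
    ≡⟨ sym (pos-* (suc m) (m !)) ⟩
  + (suc m !)
    ∎
  where
  a b : ℕ → ℤ
  a j = + (m C j) * derange j
  b j = + (suc m C suc j) * -1ℤ ^ suc j
  split : ∀ j → + (suc m C suc j) * derange (suc j) ≡ + suc m * a j + b j
  split j = begin
    c * derange (suc j)                   ≡⟨ cong (c *_) (derange-suc j) ⟩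
    c * (+ suc j * derange j + -1ℤ ^ suc j) ≡⟨ *-distribˡ-+ c _ _ ⟩
    c * (+ suc j * derange j) + b j       ≡⟨ cong (_+ b j) (sym (*-assoc c (+ suc j) (derange j))) ⟩
    c * + suc j * derange j + b j         ≡⟨ cong (λ e → e * derange j + b j) (trans (*-comm c (+ suc j)) (+[k+1]*+[n+1]C[k+1]≡+[n+1]*+nCk m j)) ⟩
    + suc m * + (m C j) * derange j + b j ≡⟨ cong (_+ b j) (*-assoc (+ suc m) (+ (m C j)) (derange j)) ⟩
    + suc m * a j + b j                   ∎
    where
    c : ℤ
    c = + (suc m C suc j)

-- `_C_` is itself defined by `if r ≤ᵇ k`, so the with-abstraction rewrites it on the right as well;
-- `eq` undoes that.
dkr-≤ : ∀ {k r} → r ≤ k → dkr k r ≡ + (k C r) * derange (k ∸ r)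
dkr-≤ {k} {r} r≤k with r ≤ᵇ k in eq | ℕ.≤⇒≤ᵇ r≤k
... | true | _ = cong (λ b → + (if b then k C′ (r ⊓ (k ∸ r)) else 0) * derange (k ∸ r)) eq

dkr-> : ∀ {k r} → k < r → dkr k r ≡ + 0
dkr-> {k} {r} k<r with r ≤ᵇ k | ℕ.≤ᵇ⇒≤ r k
... | false | _   = refl
... | true  | r≤k = ⊥-elim (ℕ.<⇒≱ k<r (r≤k tt))

∑-[r+1]*dkr≡! : ∀ m {n} → suc m ≤ n → ∑[ r < n ] (+ suc r * dkr (suc m) (suc r)) ≡ + (suc m !)
∑-[r+1]*dkr≡! m {n} m<n = begin
  ∑[ r < n ] f r
    ≡⟨ ∑-pad f (ℕ.≤⇒≤′ m<n) (λ r m<r → trans (cong (+ suc r *_) (dkr-> (s≤s m<r))) (*-zeroʳ (+ suc r))) ⟩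
  ∑[ r < suc m ] f r
    ≡⟨ ∑-cong-< (suc m) absorb ⟩
  ∑[ r < suc m ] (+ suc m * h r)
    ≡⟨ ∑-distribˡ-* (suc m) (+ suc m) h ⟩
  + suc m * ∑ (suc m) h
    ≡⟨ cong (+ suc m *_) (∑-reverse m h) ⟩
  + suc m * ∑[ j < suc m ] h (m ∸ j)
    ≡⟨ cong (+ suc m *_) (∑-cong-< (suc m) complement) ⟩
  + suc m * ∑[ j < suc m ] (+ (m C j) * derange j)
    ≡⟨ cong (+ suc m *_) (∑-binomial-derange≡! m) ⟩
  + suc m * + (m !)
    ≡⟨ pos-* (suc m) (m !) ⟨
  + (suc m !)
    ∎
  where
  f h : ℕ → ℤ
  f r = + suc r * dkr (suc m) (suc r)
  h r = + (m C r) * derange (m ∸ r)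
  absorb : ∀ r → r < suc m → f r ≡ + suc m * h r
  absorb r (s≤s r≤m) = begin
    + suc r * dkr (suc m) (suc r)                   ≡⟨ cong (+ suc r *_) (dkr-≤ (s≤s r≤m)) ⟩
    + suc r * (+ (suc m C suc r) * derange (m ∸ r)) ≡⟨ *-assoc (+ suc r) (+ (suc m C suc r)) (derange (m ∸ r)) ⟨
    + suc r * + (suc m C suc r) * derange (m ∸ r)   ≡⟨ cong (_* derange (m ∸ r)) (+[k+1]*+[n+1]C[k+1]≡+[n+1]*+nCk m r) ⟩
    + suc m * + (m C r) * derange (m ∸ r)           ≡⟨ *-assoc (+ suc m) (+ (m C r)) (derange (m ∸ r)) ⟩
    + suc m * h r                                   ∎
  complement : ∀ j → j < suc m → h (m ∸ j) ≡ + (m C j) * derange j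
  complement j (s≤s j≤m) = cong₂ (λ a b → + a * derange b) (sym (nCk≡nC[n∸k] j≤m)) (ℕ.m∸[m∸n]≡n j≤m)

stirling2*∑-[r+1]*dkr≡stirling2*! : ∀ n k → k ≤ suc n →
  + (stirling2 (suc n) k) * ∑[ r < suc n ] (+ suc r * dkr k (suc r)) ≡ + (stirling2 (suc n) k ℕ.* k !)
stirling2*∑-[r+1]*dkr≡stirling2*! n zero    _   = refl
stirling2*∑-[r+1]*dkr≡stirling2*! n (suc m) m<1+n = begin
  + s * ∑[ r < suc n ] (+ suc r * dkr (suc m) (suc r)) ≡⟨ cong (+ s *_) (∑-[r+1]*dkr≡! m m<1+n) ⟩
  + s * + (suc m !)                                    ≡⟨ pos-* s (suc m !) ⟨
  + (s ℕ.* suc m !)                                    ∎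
  where
  s : ℕ
  s = stirling2 (suc n) (suc m)

∑-[r+1]*wt-coefficient : ∀ n k y → k ≤ suc n →
  ∑[ r < suc n ] (+ suc r * (+ (stirling2 (suc n) k) * dkr k (suc r) * y ^ k)) ≡ + (stirling2 (suc n) k ℕ.* k !) * y ^ k
∑-[r+1]*wt-coefficient n k y k≤1+n = begin
  ∑[ r < suc n ] (+ suc r * (+ s * dkr k (suc r) * y ^ k))
    ≡⟨ ∑-cong (suc n) (λ r → reorder (+ suc r) (+ s) (dkr k (suc r)) (y ^ k)) ⟩
  ∑[ r < suc n ] (y ^ k * (+ s * (+ suc r * dkr k (suc r))))
    ≡⟨ ∑-distribˡ-* (suc n) (y ^ k) _ ⟩
  y ^ k * ∑[ r < suc n ] (+ s * (+ suc r * dkr k (suc r)))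
    ≡⟨ cong (y ^ k *_) (trans (∑-distribˡ-* (suc n) (+ s) _) (stirling2*∑-[r+1]*dkr≡stirling2*! n k k≤1+n)) ⟩
  y ^ k * + (s ℕ.* k !)
    ≡⟨ *-comm (y ^ k) _ ⟩
  + (s ℕ.* k !) * y ^ k
    ∎
  where
  s : ℕ
  s = stirling2 (suc n) k
  reorder : ∀ c a d p → c * (a * d * p) ≡ p * (a * (c * d))
  reorder = solve-∀

mainTheorem15 : (n : ℕ) → 1 Data.Nat.≤ n → (y : ℤ) →
    sumFromTo 1 n (λ r → + r * wt n r y) ≡ w n y
mainTheorem15 n@(suc n-1) _ y = begin
  sumFromTo 1 n (λ r → + r * wt n r y)
    ≡⟨ sumFromTo-1 n _ ⟩
  ∑[ r < n ] (+ suc r * wt n (suc r) y)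
    ≡⟨ ∑-cong n expand ⟩
  ∑[ r < n ] ∑[ k < suc n ] (+ suc r * term k r)
    ≡⟨ ∑-comm n (suc n) (λ r k → + suc r * term k r) ⟩
  ∑[ k < suc n ] ∑[ r < n ] (+ suc r * term k r)
    ≡⟨ ∑-cong-< (suc n) (λ k k<1+n → ∑-[r+1]*wt-coefficient n-1 k y (ℕ.≤-pred k<1+n)) ⟩
  ∑[ k < suc n ] (+ (stirling2 n k ℕ.* k !) * y ^ k)
    ≡⟨ sumFromTo-0 n _ ⟨
  w n y
    ∎
  where
  term : ℕ → ℕ → ℤ
  term k r = + (stirling2 n k) * dkr k (suc r) * y ^ k
  expand : ∀ r → + suc r * wt n (suc r) y ≡ ∑[ k < suc n ] (+ suc r * term k r)
  expand r = trans (cong (+ suc r *_) (sumFromTo-0 n _)) (sym (∑-distribˡ-* (suc n) (+ suc r) _))
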